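{- Let $\mathcal{C}$ be a category with binary products, $\Sigma$ an endofunctor with free algebras $\Sigma^{\star}X$, $B$ an endofunctor, and $\rho$ a pre-GSOS law of $\Sigma$ over $B$ with extension $\rho^{*}$. For every morphism $f\colon X\to Y$, if $\rho$ is natural with respect to $\Sigma^{\star}f$, then $\rho^{*}$ is natural with respect to $f$, i.e. $\rho^{*}_Y\circ\Sigma^{\star}(f\times Bf)=B\Sigma^{\star}f\circ\rho^{*}_X$.
   Context: Free algebras $(\Sigma^{\star}X,\iota_X)$ with universal maps $\eta_X$ form the free monad $\Sigma^{\star}$ with multiplication $\mu$. A pre-GSOS law is a family $\rho_X\colon\Sigma(X\times BX)\to B\Sigma^{\star}X$, not necessarily natural; it is natural w.r.t. $g\colon X\to Y$ if $\rho_Y\circ\Sigma(g\times Bg)=B\Sigma^{\star}g\circ\rho_X$. Its extension $\rho^{*}_X\colon\Sigma^{\star}(X\times BX)\to B\Sigma^{\star}X$ is the unique morphism with $\rho^{*}_X\circ\eta_{X\times BX}=B\eta_X\circ\mathsf{outr}$ and $\rho^{*}_X\circ\iota_{X\times BX}=B\mu_X\circ\rho_{\Sigma^{\star}X}\circ\Sigma\langle\Sigma^{\star}\mathsf{outl},\rho^{*}_X\rangle$. -}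

module Defs where

open import Level using (Level; _⊔_; suc)
open import Relation.Binary using (Rel; IsEquivalence)

record Category (o ℓ e : Level) : Set (suc (o ⊔ ℓ ⊔ e)) where
  infixr 9 _∘_
  infix  4 _≈_
  field
    Obj   : Set o
    Hom   : Obj → Obj → Set ℓ
    _≈_   : ∀ {A B} → Rel (Hom A B) e
    id    : ∀ {A} → Hom A A
    _∘_   : ∀ {A B C} → Hom B C → Hom A B → Hom A C
    equiv : ∀ {A B} → IsEquivalence (_≈_ {A} {B})
    assoc : ∀ {A B C D} {f : Hom A B} {g : Hom B C} {h : Hom C D} →
            (h ∘ g) ∘ f ≈ h ∘ (g ∘ f)
    identityˡ : ∀ {A B} {f : Hom A B} → id ∘ f ≈ f
    identityʳ : ∀ {A B} {f : Hom A B} → f ∘ id ≈ f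
    ∘-resp-≈  : ∀ {A B C} {f h : Hom B C} {g i : Hom A B} →
                f ≈ h → g ≈ i → f ∘ g ≈ h ∘ i

record Endofunctor {o ℓ e} (C : Category o ℓ e) : Set (o ⊔ ℓ ⊔ e) where
  open Category C
  field
    F₀ : Obj → Obj
    F₁ : ∀ {A B} → Hom A B → Hom (F₀ A) (F₀ B)
    identity     : ∀ {A} → F₁ (id {A}) ≈ id
    homomorphism : ∀ {A B C} {f : Hom A B} {g : Hom B C} →
                   F₁ (g ∘ f) ≈ F₁ g ∘ F₁ f
    F-resp-≈     : ∀ {A B} {f g : Hom A B} → f ≈ g → F₁ f ≈ F₁ g

record BinaryProducts {o ℓ e} (C : Category o ℓ e) : Set (o ⊔ ℓ ⊔ e) where
  open Category C
  infixr 7 _×_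
  field
    _×_   : Obj → Obj → Obj
    outl  : ∀ {A B} → Hom (A × B) A
    outr  : ∀ {A B} → Hom (A × B) B
    ⟨_,_⟩ : ∀ {A B D} → Hom D A → Hom D B → Hom D (A × B)
    projectˡ : ∀ {A B D} {f : Hom D A} {g : Hom D B} → outl ∘ ⟨ f , g ⟩ ≈ f
    projectʳ : ∀ {A B D} {f : Hom D A} {g : Hom D B} → outr ∘ ⟨ f , g ⟩ ≈ g
    unique   : ∀ {A B D} {f : Hom D A} {g : Hom D B} {h : Hom D (A × B)} →
               outl ∘ h ≈ f → outr ∘ h ≈ g → h ≈ ⟨ f , g ⟩

  _×₁_ : ∀ {A A′ B B′} → Hom A A′ → Hom B B′ → Hom (A × B) (A′ × B′)
  f ×₁ g = ⟨ f ∘ outl , g ∘ outr ⟩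

record FreeAlgebras {o ℓ e} (C : Category o ℓ e) (S : Endofunctor C)
       : Set (o ⊔ ℓ ⊔ e) where
  open Category C
  open Endofunctor S renaming (F₀ to Σ₀; F₁ to Σ₁)
  field
    Σ⋆  : Obj → Obj
    ι   : ∀ {X} → Hom (Σ₀ (Σ⋆ X)) (Σ⋆ X)
    η   : ∀ {X} → Hom X (Σ⋆ X)
    fold : ∀ {X A} → Hom (Σ₀ A) A → Hom X A → Hom (Σ⋆ X) A
    fold-η : ∀ {X A} {a : Hom (Σ₀ A) A} {h : Hom X A} → fold a h ∘ η ≈ h
    fold-ι : ∀ {X A} {a : Hom (Σ₀ A) A} {h : Hom X A} →
             fold a h ∘ ι ≈ a ∘ Σ₁ (fold a h)
    fold-unique : ∀ {X A} {a : Hom (Σ₀ A) A} {h : Hom X A} {k : Hom (Σ⋆ X) A} →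
                  k ∘ η ≈ h → k ∘ ι ≈ a ∘ Σ₁ k → k ≈ fold a h

  Σ⋆₁ : ∀ {X Y} → Hom X Y → Hom (Σ⋆ X) (Σ⋆ Y)
  Σ⋆₁ f = fold ι (η ∘ f)

  μ : ∀ {X} → Hom (Σ⋆ (Σ⋆ X)) (Σ⋆ X)
  μ = fold ι id

module GSOS {o ℓ e} (C : Category o ℓ e) (P : BinaryProducts C)
            (S : Endofunctor C) (F : FreeAlgebras C S) (B : Endofunctor C) where
  open Category C
  open BinaryProducts P
  open Endofunctor S renaming (F₀ to Σ₀; F₁ to Σ₁)
  open Endofunctor B renaming (F₀ to B₀; F₁ to B₁)
  open FreeAlgebras F

  PreGSOS : Set (o ⊔ ℓ)
  PreGSOS = (X : Obj) → Hom (Σ₀ (X × B₀ X)) (B₀ (Σ⋆ X))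

  NaturalWrt : PreGSOS → ∀ {X Y} → Hom X Y → Set e
  NaturalWrt ρ {X} {Y} g =
    ρ Y ∘ Σ₁ (g ×₁ B₁ g) ≈ B₁ (Σ⋆₁ g) ∘ ρ X

  -- r satisfies the defining equations of the extension ρ*_X
  -- (which determine ρ*_X uniquely).
  record IsExtension (ρ : PreGSOS) (X : Obj)
         (r : Hom (Σ⋆ (X × B₀ X)) (B₀ (Σ⋆ X))) : Set e where
    field
      on-η : r ∘ η ≈ B₁ η ∘ outr
      on-ι : r ∘ ι ≈ B₁ μ ∘ ρ (Σ⋆ X) ∘ Σ₁ ⟨ Σ⋆₁ outl , r ⟩

{-# OPTIONS --safe #-}
-- The pair ⟨ Σ⋆ outl , ρ*_X ⟩ is the fold of the Σ-algebra
-- ⟨ ι ∘ Σ outl , Bμ ∘ ρ_{Σ⋆X} ⟩ on Σ⋆X × BΣ⋆X along η × Bη.  Naturality of ρ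
-- with respect to Σ⋆f makes Σ⋆f × BΣ⋆f a homomorphism between these algebras
-- for X and Y, so by fold fusion both sides of the claimed square, paired with
-- Σ⋆ outl, are the same fold; projecting with outr gives the square.
module Submission where

open import Relation.Binary using (Setoid; IsEquivalence)
import Relation.Binary.Reasoning.Setoid as SetoidReasoning
open import Defs

module CategoryProperties {o ℓ e} (C : Category o ℓ e) where
  open Category C

  module ≈ {A B : Obj} = IsEquivalence (equiv {A} {B})

  hom-setoid : ∀ {A B : Obj} → Setoid ℓ e
  hom-setoid {A} {B} = record
    { Carrier = Hom A B ; _≈_ = _≈_ ; isEquivalence = equiv }

  module HomReasoning {A B : Obj} = SetoidReasoning (hom-setoid {A} {B})

  ∘-resp-≈ˡ : ∀ {A B D} {f h : Hom B D} {g : Hom A B} → f ≈ h → f ∘ g ≈ h ∘ g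
  ∘-resp-≈ˡ p = ∘-resp-≈ p ≈.refl

  ∘-resp-≈ʳ : ∀ {A B D} {f : Hom B D} {g i : Hom A B} → g ≈ i → f ∘ g ≈ f ∘ i
  ∘-resp-≈ʳ p = ∘-resp-≈ ≈.refl p

  pullˡ : ∀ {A B D E} {f : Hom D E} {g : Hom B D} {h : Hom A B} {k : Hom B E} →
          f ∘ g ≈ k → f ∘ (g ∘ h) ≈ k ∘ h
  pullˡ p = ≈.trans (≈.sym assoc) (∘-resp-≈ˡ p)

  pullʳ : ∀ {A B D E} {f : Hom D E} {g : Hom B D} {h : Hom A B} {k : Hom A D} →
          g ∘ h ≈ k → (f ∘ g) ∘ h ≈ f ∘ k
  pullʳ p = ≈.trans assoc (∘-resp-≈ʳ p)

module FunctorProperties {o ℓ e} {C : Category o ℓ e} (G : Endofunctor C) where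
  open Category C
  open Endofunctor G
  open CategoryProperties C

  F-resp-square : ∀ {A B D E} {f : Hom A B} {g : Hom A D} {h : Hom B E} {k : Hom D E} →
                  h ∘ f ≈ k ∘ g → F₁ h ∘ F₁ f ≈ F₁ k ∘ F₁ g
  F-resp-square sq = ≈.trans (≈.sym homomorphism) (≈.trans (F-resp-≈ sq) homomorphism)

module ProductProperties {o ℓ e} {C : Category o ℓ e} (P : BinaryProducts C) where
  open Category C
  open BinaryProducts P
  open CategoryProperties C

  ⟨⟩-cong₂ : ∀ {A B D} {f f′ : Hom D A} {g g′ : Hom D B} →
             f ≈ f′ → g ≈ g′ → ⟨ f , g ⟩ ≈ ⟨ f′ , g′ ⟩
  ⟨⟩-cong₂ p q = unique (≈.trans projectˡ p) (≈.trans projectʳ q)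

  ⟨⟩∘ : ∀ {A B D E} {f : Hom D A} {g : Hom D B} {h : Hom E D} →
        ⟨ f , g ⟩ ∘ h ≈ ⟨ f ∘ h , g ∘ h ⟩
  ⟨⟩∘ = unique (pullˡ projectˡ) (pullˡ projectʳ)

  ×₁∘⟨⟩ : ∀ {A A′ B B′ D} {f : Hom A A′} {g : Hom B B′} {h : Hom D A} {k : Hom D B} →
          (f ×₁ g) ∘ ⟨ h , k ⟩ ≈ ⟨ f ∘ h , g ∘ k ⟩
  ×₁∘⟨⟩ = ≈.trans ⟨⟩∘ (⟨⟩-cong₂ (pullʳ projectˡ) (pullʳ projectʳ))

  ×₁-resp-square : ∀ {A B D E A′ B′ D′ E′}
                     {f : Hom A B} {g : Hom A D} {h : Hom B E} {k : Hom D E}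
                     {f′ : Hom A′ B′} {g′ : Hom A′ D′} {h′ : Hom B′ E′} {k′ : Hom D′ E′} →
                   h ∘ f ≈ k ∘ g → h′ ∘ f′ ≈ k′ ∘ g′ →
                   (h ×₁ h′) ∘ (f ×₁ f′) ≈ (k ×₁ k′) ∘ (g ×₁ g′)
  ×₁-resp-square sq sq′ =
    ≈.trans ×₁∘⟨⟩
      (≈.trans (⟨⟩-cong₂ (pullˡ sq) (pullˡ sq′))
        (≈.trans (⟨⟩-cong₂ assoc assoc) (≈.sym ×₁∘⟨⟩)))

module FreeAlgebraProperties {o ℓ e} {C : Category o ℓ e} {S : Endofunctor C}
                             (F : FreeAlgebras C S) where
  open Category C
  open Endofunctor S renaming (F₀ to Σ₀; F₁ to Σ₁)
  open FreeAlgebras F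
  open CategoryProperties C

  IsHomomorphism : ∀ {A D} → Hom (Σ₀ A) A → Hom (Σ₀ D) D → Hom A D → Set e
  IsHomomorphism a d h = h ∘ a ≈ d ∘ Σ₁ h

  fold-isHomomorphism : ∀ {X A} {a : Hom (Σ₀ A) A} {h : Hom X A} →
                        IsHomomorphism ι a (fold a h)
  fold-isHomomorphism = fold-ι

  fold-cong : ∀ {X A} {a : Hom (Σ₀ A) A} {h h′ : Hom X A} → h ≈ h′ → fold a h ≈ fold a h′
  fold-cong p = fold-unique (≈.trans fold-η p) fold-ι

  fold-fusion : ∀ {X A D} {a : Hom (Σ₀ A) A} {d : Hom (Σ₀ D) D} {h : Hom A D}
                  {k : Hom X A} →
                IsHomomorphism a d h → h ∘ fold a k ≈ fold d (h ∘ k)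
  fold-fusion {a = a} {d} {h} {k} hom = fold-unique (pullʳ fold-η) on-ι
    where
    open HomReasoning
    on-ι : (h ∘ fold a k) ∘ ι ≈ d ∘ Σ₁ (h ∘ fold a k)
    on-ι = begin
      (h ∘ fold a k) ∘ ι     ≈⟨ pullʳ fold-ι ⟩
      h ∘ (a ∘ Σ₁ (fold a k)) ≈⟨ pullˡ hom ⟩
      (d ∘ Σ₁ h) ∘ Σ₁ (fold a k) ≈⟨ pullʳ (≈.sym homomorphism) ⟩
      d ∘ Σ₁ (h ∘ fold a k)  ∎

  fold∘Σ⋆₁ : ∀ {X Y A} {a : Hom (Σ₀ A) A} {h : Hom Y A} {g : Hom X Y} →
             fold a h ∘ Σ⋆₁ g ≈ fold a (h ∘ g)
  fold∘Σ⋆₁ = ≈.trans (fold-fusion fold-isHomomorphism) (fold-cong (pullˡ fold-η))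

  μ-natural : ∀ {X Y} {g : Hom X Y} → Σ⋆₁ g ∘ μ ≈ μ ∘ Σ⋆₁ (Σ⋆₁ g)
  μ-natural = ≈.trans (fold-fusion fold-isHomomorphism)
                (≈.trans (fold-cong (≈.trans identityʳ (≈.sym identityˡ)))
                  (≈.sym fold∘Σ⋆₁))

module ExtensionProperties {o ℓ e} {C : Category o ℓ e} (P : BinaryProducts C)
                           {S : Endofunctor C} (F : FreeAlgebras C S) (B : Endofunctor C)
                           (ρ : GSOS.PreGSOS C P S F B) where
  open Category C
  open BinaryProducts P
  open Endofunctor S using ()
    renaming (F₀ to Σ₀; F₁ to Σ₁; homomorphism to Σ-homomorphism; F-resp-≈ to Σ-resp-≈)
  open Endofunctor B using () renaming (F₀ to B₀; F₁ to B₁)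
  open FreeAlgebras F
  open GSOS C P S F B
  open CategoryProperties C
  open FunctorProperties S renaming (F-resp-square to Σ-resp-square)
  open FunctorProperties B renaming (F-resp-square to B-resp-square)
  open ProductProperties P
  open FreeAlgebraProperties F

  extension-algebra : ∀ X → Hom (Σ₀ (Σ⋆ X × B₀ (Σ⋆ X))) (Σ⋆ X × B₀ (Σ⋆ X))
  extension-algebra X = ⟨ ι ∘ Σ₁ outl , B₁ μ ∘ ρ (Σ⋆ X) ⟩

  extension-pairing≈fold : ∀ {X r} → IsExtension ρ X r →
                           ⟨ Σ⋆₁ outl , r ⟩ ≈ fold (extension-algebra X) (η ×₁ B₁ η)
  extension-pairing≈fold {r = r} ext = fold-unique
    (≈.trans ⟨⟩∘ (⟨⟩-cong₂ fold-η on-η))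
    (≈.trans ⟨⟩∘ (≈.trans (⟨⟩-cong₂ fold-ι on-ι) (≈.sym (≈.trans ⟨⟩∘ (⟨⟩-cong₂ on-outl assoc)))))
    where
    open IsExtension ext
    on-outl : (ι ∘ Σ₁ outl) ∘ Σ₁ ⟨ Σ⋆₁ outl , r ⟩ ≈ ι ∘ Σ₁ (Σ⋆₁ outl)
    on-outl = pullʳ (≈.trans (≈.sym Σ-homomorphism) (Σ-resp-≈ projectˡ))

  extension-algebra-homomorphism :
    ∀ {X Y} {f : Hom X Y} → NaturalWrt ρ (Σ⋆₁ f) →
    IsHomomorphism (extension-algebra X) (extension-algebra Y) (Σ⋆₁ f ×₁ B₁ (Σ⋆₁ f))
  extension-algebra-homomorphism {X} {Y} {f} natural =
    ≈.trans ×₁∘⟨⟩ (≈.trans (⟨⟩-cong₂ on-terms on-behaviour) (≈.sym ⟨⟩∘))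
    where
    open HomReasoning
    g : Hom (Σ⋆ X) (Σ⋆ Y)
    g = Σ⋆₁ f
    on-terms : g ∘ (ι ∘ Σ₁ outl) ≈ (ι ∘ Σ₁ outl) ∘ Σ₁ (g ×₁ B₁ g)
    on-terms = begin
      g ∘ (ι ∘ Σ₁ outl)                 ≈⟨ pullˡ fold-isHomomorphism ⟩
      (ι ∘ Σ₁ g) ∘ Σ₁ outl              ≈⟨ pullʳ (Σ-resp-square (≈.sym projectˡ)) ⟩
      ι ∘ (Σ₁ outl ∘ Σ₁ (g ×₁ B₁ g))    ≈⟨ ≈.sym assoc ⟩
      (ι ∘ Σ₁ outl) ∘ Σ₁ (g ×₁ B₁ g)    ∎
    on-behaviour : B₁ g ∘ (B₁ μ ∘ ρ (Σ⋆ X)) ≈ (B₁ μ ∘ ρ (Σ⋆ Y)) ∘ Σ₁ (g ×₁ B₁ g)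
    on-behaviour = begin
      B₁ g ∘ (B₁ μ ∘ ρ (Σ⋆ X))          ≈⟨ pullˡ (B-resp-square μ-natural) ⟩
      (B₁ μ ∘ B₁ (Σ⋆₁ g)) ∘ ρ (Σ⋆ X)    ≈⟨ pullʳ (≈.sym natural) ⟩
      B₁ μ ∘ (ρ (Σ⋆ Y) ∘ Σ₁ (g ×₁ B₁ g)) ≈⟨ ≈.sym assoc ⟩
      (B₁ μ ∘ ρ (Σ⋆ Y)) ∘ Σ₁ (g ×₁ B₁ g) ∎

  extension-pairing-natural :
    ∀ {X Y} {f : Hom X Y} {ρ*X ρ*Y} → IsExtension ρ X ρ*X → IsExtension ρ Y ρ*Y →
    NaturalWrt ρ (Σ⋆₁ f) →
    ⟨ Σ⋆₁ outl , ρ*Y ⟩ ∘ Σ⋆₁ (f ×₁ B₁ f) ≈ (Σ⋆₁ f ×₁ B₁ (Σ⋆₁ f)) ∘ ⟨ Σ⋆₁ outl , ρ*X ⟩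
  extension-pairing-natural {X} {Y} {f} {ρ*X} {ρ*Y} extX extY natural = begin
    ⟨ Σ⋆₁ outl , ρ*Y ⟩ ∘ Σ⋆₁ (f ×₁ B₁ f)
      ≈⟨ ∘-resp-≈ˡ (extension-pairing≈fold extY) ⟩
    fold (extension-algebra Y) (η ×₁ B₁ η) ∘ Σ⋆₁ (f ×₁ B₁ f)
      ≈⟨ fold∘Σ⋆₁ ⟩
    fold (extension-algebra Y) ((η ×₁ B₁ η) ∘ (f ×₁ B₁ f))
      ≈⟨ fold-cong (×₁-resp-square (≈.sym fold-η) (B-resp-square (≈.sym fold-η))) ⟩
    fold (extension-algebra Y) ((Σ⋆₁ f ×₁ B₁ (Σ⋆₁ f)) ∘ (η ×₁ B₁ η))
      ≈⟨ ≈.sym (fold-fusion (extension-algebra-homomorphism natural)) ⟩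
    (Σ⋆₁ f ×₁ B₁ (Σ⋆₁ f)) ∘ fold (extension-algebra X) (η ×₁ B₁ η)
      ≈⟨ ∘-resp-≈ʳ (≈.sym (extension-pairing≈fold extX)) ⟩
    (Σ⋆₁ f ×₁ B₁ (Σ⋆₁ f)) ∘ ⟨ Σ⋆₁ outl , ρ*X ⟩
      ∎
    where open HomReasoning

lemma46 : ∀ {o ℓ e} (C : Category o ℓ e) (P : BinaryProducts C)
            (S : Endofunctor C) (F : FreeAlgebras C S) (B : Endofunctor C) →
          let open Category C
              open BinaryProducts P
              open Endofunctor B
              open FreeAlgebras F
              open GSOS C P S F B
          in (ρ : PreGSOS) {X Y : Obj} (f : Hom X Y)
             (ρ*X : Hom (Σ⋆ (X × F₀ X)) (F₀ (Σ⋆ X)))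
             (ρ*Y : Hom (Σ⋆ (Y × F₀ Y)) (F₀ (Σ⋆ Y))) →
             IsExtension ρ X ρ*X → IsExtension ρ Y ρ*Y →
             NaturalWrt ρ (Σ⋆₁ f) →
             ρ*Y ∘ Σ⋆₁ (f ×₁ F₁ f) ≈ F₁ (Σ⋆₁ f) ∘ ρ*X
lemma46 C P S F B ρ f ρ*X ρ*Y extX extY natural = begin
  ρ*Y ∘ Σ⋆₁ (f ×₁ F₁ f)
    ≈⟨ ∘-resp-≈ˡ (≈.sym projectʳ) ⟩
  (outr ∘ ⟨ Σ⋆₁ outl , ρ*Y ⟩) ∘ Σ⋆₁ (f ×₁ F₁ f)
    ≈⟨ pullʳ (extension-pairing-natural extX extY natural) ⟩
  outr ∘ ((Σ⋆₁ f ×₁ F₁ (Σ⋆₁ f)) ∘ ⟨ Σ⋆₁ outl , ρ*X ⟩)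
    ≈⟨ pullˡ projectʳ ⟩
  (F₁ (Σ⋆₁ f) ∘ outr) ∘ ⟨ Σ⋆₁ outl , ρ*X ⟩
    ≈⟨ pullʳ projectʳ ⟩
  F₁ (Σ⋆₁ f) ∘ ρ*X
    ∎
  where
  open Category C
  open BinaryProducts P
  open Endofunctor B
  open FreeAlgebras F
  open CategoryProperties C
  open HomReasoning
  open ExtensionProperties P F B ρ
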